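{- Let $F$ and $g$ be positive integers such that $g \leq F \leq 2g-1$, and let $\mathcal{A}_{F,g} = \{A : A \subseteq \{\lceil\frac{F+1}{2}\rceil, \ldots, F-1\} \text{ and } \#A = F-g\}$. Then $$\mathcal{E}(F,g) = \{A \cup \{z \in \mathbb{Z} : z \geq F+1\} \cup \{0\} : A \in \mathcal{A}_{F,g}\}.$$
   Context: A numerical semigroup is a subset $S \subseteq \mathbb{N}$ (with $\mathbb{N}$ the nonnegative integers) closed under addition, containing $0$, with $\mathbb{N}\setminus S$ finite. The genus of $S$ is $\#(\mathbb{N}\setminus S)$; the Frobenius number $\mathrm{F}(S)$ is the largest integer not in $S$; the multiplicity $\mathrm{m}(S)$ is the least positive integer in $S$. $S$ is called elementary if $\mathrm{F}(S) < 2\,\mathrm{m}(S)$. $\mathcal{E}(F,g)$ denotes the set of elementary numerical semigroups with Frobenius number $F$ and genus $g$. -}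

module Defs where

open import Data.Nat using (ℕ; zero; suc; _+_; _*_; _∸_; _≤_; _<_; ⌈_/2⌉)
open import Data.Bool using (Bool; true; false; not; _∨_)
open import Data.Product using (Σ; _×_; ∃; ∃-syntax)
open import Relation.Binary.PropositionalEquality using (_≡_)
open import Relation.Nullary using (¬_)
open import Relation.Nullary.Decidable using (⌊_⌋)
open import Data.Nat using (_≤?_; _≟_)

Subset : Set
Subset = ℕ → Bool

countBelow : Subset → ℕ → ℕ
countBelow P zero = 0
countBelow P (suc N) with P N
... | true  = suc (countBelow P N)
... | false = countBelow P N

HasCard : Subset → ℕ → Set
HasCard P k = Σ ℕ λ N → (∀ n → N ≤ n → P n ≡ false) × (countBelow P N ≡ k)

complement : Subset → Subset
complement S n = not (S n)

record IsNumericalSemigroup (S : Subset) : Set where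
  field
    zero∈    : S 0 ≡ true
    closed+  : ∀ a b → S a ≡ true → S b ≡ true → S (a + b) ≡ true
    cofinite : Σ ℕ λ N → ∀ n → N ≤ n → S n ≡ true

Genus : Subset → ℕ → Set
Genus S g = HasCard (complement S) g

IsFrobenius : Subset → ℕ → Set
IsFrobenius S F = (S F ≡ false) × (∀ n → F < n → S n ≡ true)

IsMultiplicity : Subset → ℕ → Set
IsMultiplicity S m = (0 < m) × (S m ≡ true) × (∀ k → 0 < k → k < m → S k ≡ false)

IsElementary : Subset → Set
IsElementary S = Σ ℕ λ F → Σ ℕ λ m → IsFrobenius S F × IsMultiplicity S m × (F < 2 * m)

InE : ℕ → ℕ → Subset → Set
InE F g S = IsNumericalSemigroup S × IsElementary S × IsFrobenius S F × Genus S g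

InA : ℕ → ℕ → Subset → Set
InA F g A = (∀ n → A n ≡ true → (⌈ (F + 1) /2⌉ ≤ n) × (n ≤ F ∸ 1)) × HasCard A (F ∸ g)

fromA : ℕ → Subset → Subset
fromA F A n = A n ∨ ⌊ suc F ≤? n ⌋ ∨ ⌊ n ≟ 0 ⌋

-- Write c = ⌈(F+1)/2⌉, the least n with F < n + n. If every nonzero element of S is at least c
-- and everything above F lies in S, then S is closed under addition, since a sum of two nonzero
-- elements exceeds F; and its multiplicity m satisfies c ≤ m, so F < 2m. Conversely, in an
-- elementary semigroup every nonzero element is at least m > F/2, hence at least c. So ℰ(F,g)
-- consists of the sets {0} ∪ A ∪ (F, ∞) with A ⊆ [c, F-1], and counting the elements of
-- {0, …, F} in and outside S gives g + #A = F.
module Submission where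

open import Defs
open import Data.Nat using (ℕ; zero; suc; _+_; _*_; _∸_; _≤_; _<_; _≤′_; ≤′-refl; ≤′-step; s≤s; s≤s⁻¹; z<s; ⌈_/2⌉; ⌊_/2⌋)
open import Data.Nat.Properties
open import Data.Bool using (Bool; true; false; not; _∨_; _∧_)
open import Data.Bool.Properties using (∨-identityʳ; ∨-zeroʳ; ∧-zeroʳ; ¬-not)
open import Data.Product using (Σ; _×_; _,_; proj₁; proj₂)
open import Data.Sum using (inj₁; inj₂)
open import Function using (_∘_)
open import Relation.Binary.PropositionalEquality
open import Relation.Nullary using (Dec; ¬_; yes; no; contradiction)
open import Relation.Nullary.Decidable using (⌊_⌋; isYes≗does; dec-true; dec-false)
open import Algebra.Properties.CommutativeSemigroup +-commutativeSemigroup using (interchange; x∙yz≈y∙xz)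
open ≡-Reasoning

indicator : Bool → ℕ
indicator true  = 1
indicator false = 0

indicator-+-not : ∀ b → indicator b + indicator (not b) ≡ 1
indicator-+-not true  = refl
indicator-+-not false = refl

countBelow-suc : ∀ P N → countBelow P (suc N) ≡ indicator (P N) + countBelow P N
countBelow-suc P N with P N
... | true  = refl
... | false = refl

countBelow-cong : ∀ {P Q} N → (∀ n → n < N → P n ≡ Q n) → countBelow P N ≡ countBelow Q N
countBelow-cong zero _ = refl
countBelow-cong {P} {Q} (suc N) P≡Q = begin
  countBelow P (suc N)              ≡⟨ countBelow-suc P N ⟩
  indicator (P N) + countBelow P N  ≡⟨ cong₂ _+_ (cong indicator (P≡Q N ≤-refl))
                                              (countBelow-cong N (λ n n<N → P≡Q n (m≤n⇒m≤1+n n<N))) ⟩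
  indicator (Q N) + countBelow Q N  ≡⟨ countBelow-suc Q N ⟨
  countBelow Q (suc N)              ∎

countBelow-+-complement : ∀ P N → countBelow P N + countBelow (complement P) N ≡ N
countBelow-+-complement P zero = refl
countBelow-+-complement P (suc N) = begin
  countBelow P (suc N) + countBelow (complement P) (suc N)
    ≡⟨ cong₂ _+_ (countBelow-suc P N) (countBelow-suc (complement P) N) ⟩
  (indicator (P N) + countBelow P N) + (indicator (not (P N)) + countBelow (complement P) N)
    ≡⟨ interchange (indicator (P N)) (countBelow P N)
                   (indicator (not (P N))) (countBelow (complement P) N) ⟩
  (indicator (P N) + indicator (not (P N))) + (countBelow P N + countBelow (complement P) N)
    ≡⟨ cong₂ _+_ (indicator-+-not (P N)) (countBelow-+-complement P N) ⟩
  suc N ∎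

countBelow-shift : ∀ P N → countBelow P (suc N) ≡ indicator (P 0) + countBelow (P ∘ suc) N
countBelow-shift P zero = countBelow-suc P 0
countBelow-shift P (suc N) = begin
  countBelow P (suc (suc N))
    ≡⟨ countBelow-suc P (suc N) ⟩
  indicator (P (suc N)) + countBelow P (suc N)
    ≡⟨ cong (indicator (P (suc N)) +_) (countBelow-shift P N) ⟩
  indicator (P (suc N)) + (indicator (P 0) + countBelow (P ∘ suc) N)
    ≡⟨ x∙yz≈y∙xz (indicator (P (suc N))) (indicator (P 0)) (countBelow (P ∘ suc) N) ⟩
  indicator (P 0) + (indicator (P (suc N)) + countBelow (P ∘ suc) N)
    ≡⟨ cong (indicator (P 0) +_) (countBelow-suc (P ∘ suc) N) ⟨
  indicator (P 0) + countBelow (P ∘ suc) (suc N) ∎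

countBelow-beyond : ∀ P {a b} → a ≤ b → (∀ n → a ≤ n → P n ≡ false) → countBelow P b ≡ countBelow P a
countBelow-beyond P {a} a≤b vanish = go (≤⇒≤′ a≤b)
  where
  go : ∀ {b} → a ≤′ b → countBelow P b ≡ countBelow P a
  go ≤′-refl = refl
  go (≤′-step {n} a≤′n) = begin
    countBelow P (suc n)              ≡⟨ countBelow-suc P n ⟩
    indicator (P n) + countBelow P n  ≡⟨ cong₂ _+_ (cong indicator (vanish n (≤′⇒≤ a≤′n))) (go a≤′n) ⟩
    countBelow P a                    ∎

hasCard⇒countBelow : ∀ {P k} N → HasCard P k → (∀ n → N ≤ n → P n ≡ false) → countBelow P N ≡ k
hasCard⇒countBelow {P} N (M , vanishM , countM) vanishN with ≤-total M N
... | inj₁ M≤N = trans (countBelow-beyond P M≤N vanishM) countM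
... | inj₂ N≤M = trans (sym (countBelow-beyond P N≤M vanishN)) countM

F<⌈[F+1]/2⌉+⌈[F+1]/2⌉ : ∀ F → F < ⌈ (F + 1) /2⌉ + ⌈ (F + 1) /2⌉
F<⌈[F+1]/2⌉+⌈[F+1]/2⌉ F = subst (_≤ c + c) ⌊⌋+⌈⌉≡F+1 (+-monoˡ-≤ c (⌊n/2⌋≤⌈n/2⌉ (F + 1)))
  where
  c = ⌈ (F + 1) /2⌉
  ⌊⌋+⌈⌉≡F+1 : ⌊ (F + 1) /2⌋ + c ≡ suc F
  ⌊⌋+⌈⌉≡F+1 = trans (⌊n/2⌋+⌈n/2⌉≡n (F + 1)) (+-comm F 1)

⌈[F+1]/2⌉-least : ∀ {F n} → F < n + n → ⌈ (F + 1) /2⌉ ≤ n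
⌈[F+1]/2⌉-least {F} {n} F<n+n =
  subst (⌈ (F + 1) /2⌉ ≤_) (sym (n≡⌈n+n/2⌉ n)) (⌈n/2⌉-mono (subst (_≤ n + n) (+-comm 1 F) F<n+n))

<⇒≤∸1 : ∀ {m n} → m < n → m ≤ n ∸ 1
<⇒≤∸1 {n = suc n} m<n = s≤s⁻¹ m<n

≤∸1⇒< : ∀ {m n} → 0 < n → m ≤ n ∸ 1 → m < n
≤∸1⇒< {n = suc n} _ m≤n = s≤s m≤n

⌊⌋-yes : ∀ {p} {P : Set p} (P? : Dec P) → P → ⌊ P? ⌋ ≡ true
⌊⌋-yes P? p = trans (isYes≗does P?) (dec-true P? p)

⌊⌋-no : ∀ {p} {P : Set p} (P? : Dec P) → ¬ P → ⌊ P? ⌋ ≡ false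
⌊⌋-no P? ¬p = trans (isYes≗does P?) (dec-false P? ¬p)

fromA-zero : ∀ F A → fromA F A 0 ≡ true
fromA-zero F A = ∨-zeroʳ (A 0)

fromA-above : ∀ {F} A {n} → F < n → fromA F A n ≡ true
fromA-above {F} A {n} F<n =
  trans (cong (λ b → A n ∨ (b ∨ ⌊ n ≟ 0 ⌋)) (⌊⌋-yes (suc F ≤? n) F<n)) (∨-zeroʳ (A n))

fromA-below : ∀ {F} A {n} → 0 < n → n ≤ F → fromA F A n ≡ A n
fromA-below {F} A {n} 0<n n≤F =
  trans (cong₂ (λ b c → A n ∨ (b ∨ c)) (⌊⌋-no (suc F ≤? n) (≤⇒≯ n≤F)) (⌊⌋-no (n ≟ 0) (n>0⇒n≢0 0<n)))
        (∨-identityʳ (A n))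

≗-fromA : ∀ {F A T} → T 0 ≡ true → (∀ n → 0 < n → n ≤ F → T n ≡ A n) → (∀ n → F < n → T n ≡ true) →
  T ≗ fromA F A
≗-fromA {F} {A} T0 _ _ zero = trans T0 (sym (fromA-zero F A))
≗-fromA {F} {A} T0 below above (suc n) with suc n ≤? F
... | yes n<F = trans (below _ z<s n<F) (sym (fromA-below A z<s n<F))
... | no n≰F  = trans (above _ (≰⇒> n≰F)) (sym (fromA-above A (≰⇒> n≰F)))

countBelow-fromA : ∀ F A → A 0 ≡ false → countBelow (fromA F A) (suc F) ≡ suc (countBelow A (suc F))
countBelow-fromA F A A0 = begin
  countBelow (fromA F A) (suc F)
    ≡⟨ countBelow-shift (fromA F A) F ⟩
  indicator (fromA F A 0) + countBelow (fromA F A ∘ suc) F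
    ≡⟨ cong₂ _+_ (cong indicator (fromA-zero F A)) (countBelow-cong F (λ n n<F → fromA-below A z<s n<F)) ⟩
  suc (countBelow (A ∘ suc) F)
    ≡⟨ cong (λ b → suc (indicator b + countBelow (A ∘ suc) F)) A0 ⟨
  suc (indicator (A 0) + countBelow (A ∘ suc) F)
    ≡⟨ cong suc (countBelow-shift A F) ⟨
  suc (countBelow A (suc F)) ∎

gaps-+-countBelow≡F : ∀ {F S} A → S ≗ fromA F A → A 0 ≡ false →
  countBelow (complement S) (suc F) + countBelow A (suc F) ≡ F
gaps-+-countBelow≡F {F} {S} A S≗fromA A0 = suc-injective (begin
  suc (gaps + countBelow A (suc F))     ≡⟨ cong suc (+-comm gaps _) ⟩
  suc (countBelow A (suc F)) + gaps     ≡⟨ cong (_+ gaps) (countBelow-fromA F A A0) ⟨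
  countBelow (fromA F A) (suc F) + gaps ≡⟨ cong (_+ gaps) (countBelow-cong (suc F) (λ n _ → S≗fromA n)) ⟨
  countBelow S (suc F) + gaps           ≡⟨ countBelow-+-complement S (suc F) ⟩
  suc F                                 ∎)
  where gaps = countBelow (complement S) (suc F)

gaps-vanish : ∀ {S F} → IsFrobenius S F → ∀ n → F < n → complement S n ≡ false
gaps-vanish (_ , above) n F<n = cong not (above n F<n)

genus⇒countBelow : ∀ {S F g} → IsFrobenius S F → Genus S g → countBelow (complement S) (suc F) ≡ g
genus⇒countBelow frobenius genus = hasCard⇒countBelow _ genus (gaps-vanish frobenius)

countBelow⇒genus : ∀ {S F g} → IsFrobenius S F → countBelow (complement S) (suc F) ≡ g → Genus S g
countBelow⇒genus {F = F} frobenius count = suc F , gaps-vanish frobenius , count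

frobenius-maximal : ∀ {S F n} → IsFrobenius S F → S n ≡ false → n ≤ F
frobenius-maximal (_ , above) Sn = ≮⇒≥ λ F<n → contradiction (trans (sym Sn) (above _ F<n)) λ ()

frobenius-unique : ∀ {S F F′} → IsFrobenius S F → IsFrobenius S F′ → F ≡ F′
frobenius-unique frobenius frobenius′ =
  ≤-antisym (frobenius-maximal frobenius′ (proj₁ frobenius)) (frobenius-maximal frobenius (proj₁ frobenius′))

multiplicity-minimal : ∀ {S m n} → IsMultiplicity S m → 0 < n → S n ≡ true → m ≤ n
multiplicity-minimal (_ , _ , below) 0<n Sn = ≮⇒≥ λ n<m → contradiction (trans (sym Sn) (below _ 0<n n<m)) λ ()

least-witness : ∀ (P : Subset) N → P N ≡ true → Σ ℕ λ m → P m ≡ true × (∀ k → k < m → P k ≡ false)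
least-witness P zero PN = 0 , PN , λ _ ()
least-witness P (suc N) PN with P 0 in P0
... | true  = 0 , P0 , λ _ ()
... | false with least-witness (P ∘ suc) N PN
...   | m , Pm , below = suc m , Pm , λ where
          zero    _   → P0
          (suc k) k<m → below k (s≤s⁻¹ k<m)

multiplicity-exists : ∀ {S n} → S (suc n) ≡ true → Σ ℕ (IsMultiplicity S)
multiplicity-exists {S} {n} Sn with least-witness (S ∘ suc) n Sn
... | m , Sm , below = suc m , z<s , Sm , λ where
        (suc k) _ k<m → below k (s≤s⁻¹ k<m)

closed+-if-large : ∀ {S : Subset} {F c} → (∀ n → F < n → S n ≡ true) → (∀ n → 0 < n → S n ≡ true → c ≤ n) →
  F < c + c → ∀ (a b : ℕ) → S a ≡ true → S b ≡ true → S (a + b) ≡ true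
closed+-if-large _ _ _ zero b _ Sb = Sb
closed+-if-large {S} _ _ _ (suc a) zero Sa _ = subst (λ n → S n ≡ true) (sym (+-identityʳ (suc a))) Sa
closed+-if-large above large F<c+c (suc a) (suc b) Sa Sb =
  above _ (<-≤-trans F<c+c (+-mono-≤ (large _ z<s Sa) (large _ z<s Sb)))

fromA⇒InE : ∀ {F g A S} → 0 < F → g ≤ F → InA F g A → S ≗ fromA F A → InE F g S
fromA⇒InE {F} {g} {A} {S} 0<F g≤F (A-bounds , A-card) S≗fromA =
  semigroup , (F , m , frobenius , multiplicity , F<2m) , frobenius , countBelow⇒genus frobenius gaps≡g
  where
  c = ⌈ (F + 1) /2⌉

  F<c+c : F < c + c
  F<c+c = F<⌈[F+1]/2⌉+⌈[F+1]/2⌉ F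

  A-zero : A 0 ≡ false
  A-zero = ¬-not λ A0 → let c≤0 = proj₁ (A-bounds 0 A0) in n≮0 (<-≤-trans F<c+c (+-mono-≤ c≤0 c≤0))

  A-beyond : ∀ n → F ≤ n → A n ≡ false
  A-beyond n F≤n = ¬-not λ An → ≤⇒≯ F≤n (≤∸1⇒< 0<F (proj₂ (A-bounds n An)))

  S-above : ∀ n → F < n → S n ≡ true
  S-above n F<n = trans (S≗fromA n) (fromA-above A F<n)

  S-large : ∀ n → 0 < n → S n ≡ true → c ≤ n
  S-large n 0<n Sn with n ≤? F
  ... | yes n≤F = proj₁ (A-bounds n (trans (sym (fromA-below A 0<n n≤F)) (trans (sym (S≗fromA n)) Sn)))
  ... | no  n≰F = ≤-trans (⌈n/2⌉≤n (F + 1)) (subst (_≤ n) (+-comm 1 F) (≰⇒> n≰F))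

  frobenius : IsFrobenius S F
  frobenius = trans (S≗fromA F) (trans (fromA-below A 0<F ≤-refl) (A-beyond F ≤-refl)) , S-above

  semigroup : IsNumericalSemigroup S
  semigroup = record
    { zero∈    = trans (S≗fromA 0) (fromA-zero F A)
    ; closed+  = closed+-if-large S-above S-large F<c+c
    ; cofinite = suc F , S-above
    }

  S-multiplicity : Σ ℕ (IsMultiplicity S)
  S-multiplicity = multiplicity-exists {S} (S-above (suc F) ≤-refl)

  m = proj₁ S-multiplicity
  multiplicity = proj₂ S-multiplicity

  F<2m : F < 2 * m
  F<2m = subst (F <_) (cong (m +_) (sym (+-identityʳ m)))
    (<-≤-trans F<c+c (+-mono-≤ c≤m c≤m))
    where c≤m = S-large m (proj₁ multiplicity) (proj₁ (proj₂ multiplicity))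

  A-count : countBelow A (suc F) ≡ F ∸ g
  A-count = hasCard⇒countBelow (suc F) A-card (λ n F<n → A-beyond n (<⇒≤ F<n))

  gaps≡g : countBelow (complement S) (suc F) ≡ g
  gaps≡g = +-cancelʳ-≡ (F ∸ g) _ g (begin
    gaps + (F ∸ g)                ≡⟨ cong (gaps +_) A-count ⟨
    gaps + countBelow A (suc F)   ≡⟨ gaps-+-countBelow≡F A S≗fromA A-zero ⟩
    F                             ≡⟨ m+[n∸m]≡n g≤F ⟨
    g + (F ∸ g)                   ∎)
    where gaps = countBelow (complement S) (suc F)

innerPart : ℕ → Subset → Subset
innerPart F S n = ⌊ 1 ≤? n ⌋ ∧ (⌊ n <? F ⌋ ∧ S n)

innerPart-true : ∀ F S {n} → innerPart F S n ≡ true → 0 < n × n < F × S n ≡ true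
innerPart-true F S {n} inner with 1 ≤? n | n <? F | S n
... | yes 0<n | yes n<F | true  = 0<n , n<F , refl
... | yes _   | yes _   | false = contradiction inner λ ()
... | yes _   | no _    | _     = contradiction inner λ ()
... | no _    | _       | _     = contradiction inner λ ()

innerPart-beyond : ∀ F S {n} → F ≤ n → innerPart F S n ≡ false
innerPart-beyond F S {n} F≤n =
  trans (cong (λ b → ⌊ 1 ≤? n ⌋ ∧ (b ∧ S n)) (⌊⌋-no (n <? F) (≤⇒≯ F≤n))) (∧-zeroʳ ⌊ 1 ≤? n ⌋)

innerPart-agrees : ∀ F S {n} → S F ≡ false → 0 < n → n ≤ F → S n ≡ innerPart F S n
innerPart-agrees F S {n} SF 0<n n≤F with m≤n⇒m<n∨m≡n n≤F
... | inj₁ n<F  = sym (cong₂ (λ a b → a ∧ (b ∧ S n)) (⌊⌋-yes (1 ≤? n) 0<n) (⌊⌋-yes (n <? F) n<F))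
... | inj₂ refl = trans SF (sym (innerPart-beyond F S ≤-refl))

InE⇒fromA : ∀ {F g S} → InE F g S → Σ Subset λ A → InA F g A × S ≗ fromA F A
InE⇒fromA {F} {g} {S} (semigroup , (F′ , m , frobenius′ , multiplicity , F′<2m) , frobenius , genus) =
  A , (A-bounds , suc F , A-beyond , A-count) , S≗fromA
  where
  open IsNumericalSemigroup semigroup using (zero∈)
  A = innerPart F S

  F<m+m : F < m + m
  F<m+m = subst₂ _<_ (frobenius-unique frobenius′ frobenius) (cong (m +_) (+-identityʳ m)) F′<2m

  A-bounds : ∀ n → A n ≡ true → ⌈ (F + 1) /2⌉ ≤ n × n ≤ F ∸ 1
  A-bounds n An with innerPart-true F S An
  ... | 0<n , n<F , Sn = ⌈[F+1]/2⌉-least (<-≤-trans F<m+m (+-mono-≤ m≤n m≤n)) , <⇒≤∸1 n<F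
    where m≤n = multiplicity-minimal multiplicity 0<n Sn

  A-beyond : ∀ n → suc F ≤ n → A n ≡ false
  A-beyond n F<n = innerPart-beyond F S (<⇒≤ F<n)

  S≗fromA : S ≗ fromA F A
  S≗fromA = ≗-fromA zero∈ (λ n → innerPart-agrees F S (proj₁ frobenius)) (proj₂ frobenius)

  A-count : countBelow A (suc F) ≡ F ∸ g
  A-count = begin
    countBelow A (suc F)              ≡⟨ m+n∸m≡n g _ ⟨
    g + countBelow A (suc F) ∸ g      ≡⟨ cong (_∸ g) g+count≡F ⟩
    F ∸ g                             ∎
    where
    g+count≡F : g + countBelow A (suc F) ≡ F
    g+count≡F = subst (λ k → k + countBelow A (suc F) ≡ F) (genus⇒countBelow frobenius genus)
                      (gaps-+-countBelow≡F A S≗fromA refl)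

corollary3 : (F g : ℕ) → 0 < F → 0 < g → g ≤ F → F ≤ 2 * g ∸ 1 →
    (S : Subset) →
      (InE F g S → Σ Subset λ A → InA F g A × (∀ n → S n ≡ fromA F A n))
      × ((Σ Subset λ A → InA F g A × (∀ n → S n ≡ fromA F A n)) → InE F g S)
-- 0 < g and F ≤ 2g - 1 only make 𝒜_{F,g} nonempty; the two families agree without them.
corollary3 F g 0<F _ g≤F _ S = InE⇒fromA , λ (A , A∈𝒜 , S≗fromA) → fromA⇒InE 0<F g≤F A∈𝒜 S≗fromA
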